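{- Let $m$ and $n$ be positive integers such that $n$ is composite, $n$ is squarefree, and for every prime divisor $p$ of $n$ and every integer $r$ with $1\le r\le m$ there is an integer $i\ge 0$ with $n\equiv p^i \pmod{p^r-1}$. Then for every integer $r$ with $1\le r\le m$ we have $\binom{n}{r}\equiv 0 \pmod n$. -}

module Defs where

open import Data.Nat using (ℕ; _*_)
open import Data.Nat.Divisibility using (_∣_)
open import Data.Nat.Primality using (Prime)
open import Data.Integer using (ℤ; +_; _-_)
import Data.Integer.Divisibility as ℤD
open import Relation.Nullary using (¬_)

SquareFree : ℕ → Set
SquareFree n = ∀ p → Prime p → ¬ (p * p ∣ n)

infix 4 _≡_[mod_]
_≡_[mod_] : ℕ → ℕ → ℕ → Set
a ≡ b [mod k ] = (+ k) ℤD.∣ ((+ a) - (+ b))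

-- Since r · C(n, r) = n · C(n - 1, r - 1), it suffices that n and r are coprime, i.e. that
-- every prime p ∣ n exceeds m. As n is composite and squarefree it has another prime factor
-- q with p ∤ q, and by pigeonhole p ∣ qᵈ - 1 for some 1 ≤ d ≤ p. If p ≤ m, the hypothesis
-- n ≡ qⁱ (mod qᵈ - 1) gives p ∣ qⁱ, hence p ∣ q: a contradiction.
module Submission where

open import Defs
open import Data.Nat using (ℕ; _≤_; _^_; _∸_)
open import Data.Nat.Divisibility using (_∣_)
open import Data.Nat.Primality using (Prime; Composite)
open import Data.Nat.Combinatorics using (_C_)
open import Data.Product using (∃-syntax)

open import Data.Nat using (zero; suc; _+_; _*_; _<_; s≤s; s≤s⁻¹; z≤n; NonZero; n>1⇒nonTrivial; nonTrivial⇒n>1; ≢-nonZero⁻¹)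
open import Data.Nat.Properties
open import Data.Nat.Divisibility
  using (_∤_; divides; ∣-refl; ∣-trans; ∣1⇒≡1; ∣⇒≤; 0∣⇒≡0; ∣m+n∣m⇒∣n; ∣m∸n∣n⇒∣m; m∣m*n; *-monoˡ-∣)
open import Data.Nat.Divisibility.Core using (hasNonTrivialDivisor)
open import Data.Nat.Primality
  using (euclidsLemma; prime?; ¬prime⇒composite; composite⇒¬prime; composite⇒nonZero; prime⇒nonZero; ¬prime[1])
open import Data.Nat.Coprimality using (Coprime; coprime-divisor)
open import Data.Nat.DivMod using (_%_; _/_; _mod_; m≡m%n+[m/n]*n)
open import Data.Nat.Combinatorics using (nCk+nC[k+1]≡[n+1]C[k+1]; nC1≡n)
open import Data.Nat.Induction using (<-rec)
open import Data.Nat.Tactic.RingSolver using (solve-∀)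
open import Data.Integer using (_⊖_) renaming (∣_∣ to ∣_∣ℤ)
open import Data.Integer.Properties using (m-n≡m⊖n; ⊖-≥; ∣⊖∣-≤)
open import Data.Fin using (toℕ)
open import Data.Fin.Properties using (pigeonhole; toℕ-fromℕ<; toℕ<n)
open import Data.Product using (_,_; _×_; ∃₂)
open import Data.Sum using (inj₁; inj₂)
open import Data.Empty using (⊥-elim)
open import Relation.Nullary using (¬_; yes; no)
open import Relation.Binary.PropositionalEquality
open ≡-Reasoning

[k+1]*[n+1]C[k+1]≡[n+1]*nCk : ∀ n k → suc k * (suc n C suc k) ≡ suc n * (n C k)
[k+1]*[n+1]C[k+1]≡[n+1]*nCk zero    zero    = refl
[k+1]*[n+1]C[k+1]≡[n+1]*nCk zero    (suc k) = *-zeroʳ (suc (suc k))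
[k+1]*[n+1]C[k+1]≡[n+1]*nCk (suc n) zero    =
  trans (+-identityʳ _) (trans (nC1≡n (suc (suc n))) (sym (*-identityʳ (suc (suc n)))))
[k+1]*[n+1]C[k+1]≡[n+1]*nCk (suc n) (suc k) = begin
  suc (suc k) * (suc (suc n) C suc (suc k))
    ≡⟨ cong (suc (suc k) *_) (nCk+nC[k+1]≡[n+1]C[k+1] (suc n) (suc k)) ⟨
  suc (suc k) * (A + B)
    ≡⟨ regroup k A B ⟩
  A + (suc k * A + suc (suc k) * B)
    ≡⟨ cong (A +_) (cong₂ _+_ ([k+1]*[n+1]C[k+1]≡[n+1]*nCk n k)
                              ([k+1]*[n+1]C[k+1]≡[n+1]*nCk n (suc k))) ⟩
  A + (suc n * (n C k) + suc n * (n C suc k))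
    ≡⟨ cong (A +_) (*-distribˡ-+ (suc n) (n C k) (n C suc k)) ⟨
  A + suc n * (n C k + n C suc k)
    ≡⟨ cong (λ x → A + suc n * x) (nCk+nC[k+1]≡[n+1]C[k+1] n k) ⟩
  suc (suc n) * A ∎
  where
  A = suc n C suc k
  B = suc n C suc (suc k)
  regroup : ∀ k A B → suc (suc k) * (A + B) ≡ A + (suc k * A + suc (suc k) * B)
  regroup = solve-∀

coprime⇒∣C : ∀ n k → Coprime n (suc k) → n ∣ n C suc k
coprime⇒∣C zero    k _   = ∣-refl
coprime⇒∣C (suc n) k cop = coprime-divisor cop (divides (n C k) (begin
  suc k * (suc n C suc k) ≡⟨ [k+1]*[n+1]C[k+1]≡[n+1]*nCk n k ⟩
  suc n * (n C k)         ≡⟨ *-comm (suc n) (n C k) ⟩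
  (n C k) * suc n         ∎))

∃-prime-factor : ∀ n → 2 ≤ n → ∃[ p ] (Prime p × p ∣ n)
∃-prime-factor = <-rec (λ n → 2 ≤ n → ∃[ p ] (Prime p × p ∣ n)) step
  where
  step : ∀ n → (∀ {m} → m < n → 2 ≤ m → ∃[ p ] (Prime p × p ∣ m)) →
         2 ≤ n → ∃[ p ] (Prime p × p ∣ n)
  step n rec 2≤n with prime? n
  ... | yes n-prime = n , n-prime , ∣-refl
  ... | no ¬n-prime with ¬prime⇒composite {{n>1⇒nonTrivial 2≤n}} ¬n-prime
  ... | hasNonTrivialDivisor {d} d<n d∣n with rec d<n (nonTrivial⇒n>1 d)
  ... | p , p-prime , p∣d = p , p-prime , ∣-trans p∣d d∣n

prime-factors>⇒coprime : ∀ {n r} → 1 ≤ r → (∀ p → Prime p → p ∣ n → r < p) → Coprime n r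
prime-factors>⇒coprime {r = suc _} _ large {zero} (_ , 0∣r) with () ← 0∣⇒≡0 0∣r
prime-factors>⇒coprime             _ large {suc zero} _ = refl
prime-factors>⇒coprime {r = suc _} _ large {suc (suc i)} (i∣n , i∣r)
  with p , p-prime , p∣i ← ∃-prime-factor (suc (suc i)) (s≤s (s≤s z≤n)) =
  ⊥-elim (<⇒≱ (large p p-prime (∣-trans p∣i i∣n)) (∣⇒≤ (∣-trans p∣i i∣r)))

prime∣m^n⇒∣m : ∀ {p} m n → Prime p → p ∣ m ^ n → p ∣ m
prime∣m^n⇒∣m m zero    p-prime p∣1 = ⊥-elim (¬prime[1] (subst Prime (∣1⇒≡1 p∣1) p-prime))
prime∣m^n⇒∣m m (suc n) p-prime p∣mᵐ⁺¹ with euclidsLemma m (m ^ n) p-prime p∣mᵐ⁺¹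
... | inj₁ p∣m  = p∣m
... | inj₂ p∣mⁿ = prime∣m^n⇒∣m m n p-prime p∣mⁿ

∣∣m⊖n∣∧∣m⇒∣n : ∀ {d} m n → d ∣ ∣ m ⊖ n ∣ℤ → d ∣ m → d ∣ n
∣∣m⊖n∣∧∣m⇒∣n {d} m n d∣∣m⊖n∣ d∣m with ≤-total n m
... | inj₁ n≤m = ∣m+n∣m⇒∣n (subst (d ∣_) (sym (m∸n+n≡m n≤m)) d∣m)
                   (subst (d ∣_) (cong ∣_∣ℤ (⊖-≥ n≤m)) d∣∣m⊖n∣)
... | inj₂ m≤n = ∣m∸n∣n⇒∣m d m≤n (subst (d ∣_) (∣⊖∣-≤ m≤n) d∣∣m⊖n∣) d∣m

≡[mod]-∣ : ∀ {a b k d} → a ≡ b [mod k ] → d ∣ k → d ∣ a → d ∣ b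
≡[mod]-∣ {a} {b} {k} a≡b d∣k =
  ∣∣m⊖n∣∧∣m⇒∣n a b (∣-trans d∣k (subst (λ z → k ∣ ∣ z ∣ℤ) (m-n≡m⊖n a b) a≡b))

m%o≡n%o⇒o∣m∸n : ∀ m n o .{{_ : NonZero o}} → m % o ≡ n % o → o ∣ m ∸ n
m%o≡n%o⇒o∣m∸n m n o eq = divides (m / o ∸ n / o) (begin
  m ∸ n                                     ≡⟨ cong₂ _∸_ (m≡m%n+[m/n]*n m o) (m≡m%n+[m/n]*n n o) ⟩
  (m % o + m / o * o) ∸ (n % o + n / o * o) ≡⟨ cong (λ x → (x + m / o * o) ∸ (n % o + n / o * o)) eq ⟩
  (n % o + m / o * o) ∸ (n % o + n / o * o) ≡⟨ [m+n]∸[m+o]≡n∸o (n % o) (m / o * o) (n / o * o) ⟩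
  m / o * o ∸ n / o * o                     ≡⟨ *-distribʳ-∸ o (m / o) (n / o) ⟨
  (m / o ∸ n / o) * o                       ∎)

m^o∸m^n≡m^n*[m^[o∸n]∸1] : ∀ m {n o} → n ≤ o → m ^ o ∸ m ^ n ≡ m ^ n * (m ^ (o ∸ n) ∸ 1)
m^o∸m^n≡m^n*[m^[o∸n]∸1] m {n} {o} n≤o = begin
  m ^ o ∸ m ^ n                   ≡⟨ cong (λ x → m ^ x ∸ m ^ n) (m+[n∸m]≡n n≤o) ⟨
  m ^ (n + (o ∸ n)) ∸ m ^ n       ≡⟨ cong₂ _∸_ (^-distribˡ-+-* m n (o ∸ n)) (sym (*-identityʳ (m ^ n))) ⟩
  m ^ n * m ^ (o ∸ n) ∸ m ^ n * 1 ≡⟨ *-distribˡ-∸ (m ^ n) (m ^ (o ∸ n)) 1 ⟨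
  m ^ n * (m ^ (o ∸ n) ∸ 1)       ∎

∃-colliding-powers : ∀ q p .{{_ : NonZero p}} → ∃₂ λ a b → a < b × b ≤ p × q ^ b % p ≡ q ^ a % p
∃-colliding-powers q p with i , j , i<j , eq ← pigeonhole (n<1+n p) (λ t → (q ^ toℕ t) mod p) =
  toℕ i , toℕ j , i<j , s≤s⁻¹ (toℕ<n j) ,
  trans (sym (toℕ-fromℕ< _)) (trans (cong toℕ (sym eq)) (toℕ-fromℕ< _))

prime∤⇒∃∣pow∸1 : ∀ {p q} → Prime p → p ∤ q → ∃[ d ] (1 ≤ d × d ≤ p × p ∣ q ^ d ∸ 1)
prime∤⇒∃∣pow∸1 {p} {q} p-prime p∤q
  with a , b , a<b , b≤p , qᵇ≡qᵃ ← ∃-colliding-powers q p {{prime⇒nonZero p-prime}}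
  with euclidsLemma (q ^ a) (q ^ (b ∸ a) ∸ 1) p-prime
         (subst (p ∣_) (m^o∸m^n≡m^n*[m^[o∸n]∸1] q (<⇒≤ a<b))
           (m%o≡n%o⇒o∣m∸n (q ^ b) (q ^ a) p {{prime⇒nonZero p-prime}} qᵇ≡qᵃ))
... | inj₁ p∣qᵃ = ⊥-elim (p∤q (prime∣m^n⇒∣m q a p-prime p∣qᵃ))
... | inj₂ p∣qᵈ∸1 = b ∸ a , m<n⇒0<n∸m a<b , ≤-trans (m∸n≤m b a) b≤p , p∣qᵈ∸1

prime∣n∧∤q⇒m<p : ∀ {m n p q} → Prime p → p ∣ n → p ∤ q →
                  (∀ d → 1 ≤ d → d ≤ m → ∃[ i ] (n ≡ q ^ i [mod (q ^ d ∸ 1) ])) → m < p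
prime∣n∧∤q⇒m<p {m} {p = p} {q} p-prime p∣n p∤q n≡qⁱ = ≰⇒> p≰m
  where
  p≰m : ¬ p ≤ m
  p≰m p≤m with d , 1≤d , d≤p , p∣qᵈ∸1 ← prime∤⇒∃∣pow∸1 p-prime p∤q
          with i , n≡qⁱ-mod ← n≡qⁱ d 1≤d (≤-trans d≤p p≤m) =
    p∤q (prime∣m^n⇒∣m q i p-prime (≡[mod]-∣ n≡qⁱ-mod p∣qᵈ∸1 p∣n))

composite∧squarefree⇒∃other-prime-factor : ∀ {n p} → Composite n → SquareFree n →
                                           Prime p → p ∣ n → ∃[ q ] (Prime q × q ∣ n × p ∤ q)
composite∧squarefree⇒∃other-prime-factor {n} {p} n-composite sf p-prime (divides k n≡kp) = go k n≡kp
  where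
  go : ∀ k → n ≡ k * p → ∃[ q ] (Prime q × q ∣ n × p ∤ q)
  go zero          n≡0 = ⊥-elim (≢-nonZero⁻¹ n {{composite⇒nonZero n-composite}} n≡0)
  go (suc zero)    n≡p = ⊥-elim (composite⇒¬prime n-composite
                           (subst Prime (sym (trans n≡p (+-identityʳ p))) p-prime))
  go (suc (suc k)) n≡kp with q , q-prime , q∣k ← ∃-prime-factor (suc (suc k)) (s≤s (s≤s z≤n)) =
    q , q-prime , subst (q ∣_) (sym n≡kp) (∣-trans q∣k (m∣m*n p)) ,
    λ p∣q → sf p p-prime (subst (p * p ∣_) (sym n≡kp) (*-monoˡ-∣ p (∣-trans p∣q q∣k)))

lemma2 : (m n : ℕ) → 1 ≤ m → 1 ≤ n → Composite n → SquareFree n →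
    (∀ p → Prime p → p ∣ n → ∀ r → 1 ≤ r → r ≤ m →
    ∃[ i ] (n ≡ p ^ i [mod (p ^ r ∸ 1) ])) →
    ∀ r → 1 ≤ r → r ≤ m → n ∣ (n C r)
lemma2 m n _ _ n-composite sf n≡pⁱ (suc k) 1≤r r≤m =
  coprime⇒∣C n k (prime-factors>⇒coprime 1≤r prime-factors>r)
  where
  prime-factors>r : ∀ p → Prime p → p ∣ n → suc k < p
  prime-factors>r p p-prime p∣n
    with q , q-prime , q∣n , p∤q ← composite∧squarefree⇒∃other-prime-factor n-composite sf p-prime p∣n =
    ≤-<-trans r≤m (prime∣n∧∤q⇒m<p p-prime p∣n p∤q (n≡pⁱ q q-prime q∣n))
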